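{- Let $n>3$ and $S=\{f,rf,r^3f\}\subseteq D_n$. Then $S$ generates $D_n$ and $\lambda_1(D_n,S)\le\lfloor n/2\rfloor+1$.
   Context: The dihedral group $D_n$ is the group of order $2n$ with presentation $\langle r,f\mid r^n=f^2=1,\ rf=fr^{ -1}\rangle$. For a generating set $S$ of a finite group $G$ and $g\in G$, $l_S(g)$ is the minimal number of factors in an expression of $g$ as a product of elements of $S$ ($l_S(1)=0$). Define $\lambda_1(G,S)=\max_{g\in G,\,s\in S} l_S(gsg^{ -1})$. $\lfloor x\rfloor$ is the greatest integer $\le x$. -}

module Defs where

open import Data.Nat using (ℕ; zero; suc; _+_; _∸_; _≤_; NonZero)
open import Data.Nat.DivMod using (_mod_)
open import Data.Fin using (Fin; toℕ)
open import Data.Bool using (Bool; true; false; _xor_)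
open import Data.Product using (_×_; _,_; ∃-syntax)
open import Data.List using (List; []; _∷_; length; foldr)
open import Data.List.Relation.Unary.All using (All)
open import Data.List.Membership.Propositional using (_∈_)
open import Relation.Binary.PropositionalEquality using (_≡_)

-- The dihedral group D_n of order 2n: the element (k , e) stands for r^k f^e
-- (k taken mod n, e = true meaning one factor f).  Relations r^n = f^2 = 1,
-- r f = f r⁻¹, i.e. f r^b = r^(-b) f.
D : ℕ → Set
D n = Fin n × Bool

module _ {n : ℕ} .{{_ : NonZero n}} where

  rot : ℕ → D n
  rot k = (k mod n , false)

  refl′ : ℕ → D n
  refl′ k = (k mod n , true)

  one : D n
  one = rot 0

  -- (r^a f^e)(r^b f^d) = r^(a ± b) f^(e xor d), sign − iff e = true
  infixl 7 _·_
  _·_ : D n → D n → D n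
  (a , false) · (b , d) = ((toℕ a + toℕ b) mod n , d)
  (a , true)  · (b , d) = ((toℕ a + (n ∸ toℕ b)) mod n , true xor d)

  _⁻¹ : D n → D n
  (a , false) ⁻¹ = ((n ∸ toℕ a) mod n , false)
  (a , true)  ⁻¹ = (a , true)

  prod : List (D n) → D n
  prod = foldr _·_ one

  IsWord : List (D n) → List (D n) → Set
  IsWord S w = All (_∈ S) w

  Generates : List (D n) → Set
  Generates S = (g : D n) → ∃[ w ] (IsWord S w × prod w ≡ g)

  WordLength : List (D n) → D n → ℕ → Set
  WordLength S g k =
    (∃[ w ] (IsWord S w × prod w ≡ g × length w ≡ k)) ×
    ((w : List (D n)) → IsWord S w → prod w ≡ g → k ≤ length w)

  λ₁≤ : List (D n) → ℕ → Set
  λ₁≤ S b = (g s : D n) → s ∈ S →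
    ∃[ k ] (WordLength S (g · s · (g ⁻¹)) k × k ≤ b)

S₃ : (n : ℕ) .{{_ : NonZero n}} → List (D n)
S₃ n = refl′ 0 ∷ refl′ 1 ∷ refl′ 3 ∷ []

module Submission where

-- Write f_a for the reflection r^a f, so that S₃ = {f₀ , f₁ , f₃}.
-- Two facts about D_n drive the proof.
--  * A conjugate g s g⁻¹ of a reflection s is again a reflection, so the
--    bound on λ₁ amounts to bounding the word length of every reflection.
--  * f_a f_b f_z = f_x whenever x + b ≡ a + z (mod n).  In particular
--    f₃ f₀ f_x = f_(x+3) and f₀ f₃ f_(x+3) = f_x: two more letters move the
--    index of a reflection by ±3.
-- Starting from f₀, f₁, f₂ = f₃ f₁ f₀ this writes f_c with at most c + 1
-- letters, and starting from f_n = f₀, f_(n-1) = f₀ f₁ f₀, f_(n-2) = f₀ f₃ f₁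
-- it writes f_(n-y) with at most y + 1 letters (3 letters when y = 1).  One
-- of c and n - c is at most ⌊n/2⌋, which gives ⌊n/2⌋ + 1 once n > 3.
-- Rotations are products f₀ f_z, so S₃ generates D_n.
-- Finally, since "g is a product of exactly k letters" is decidable, a word of
-- length ≤ b for g yields a minimal one, i.e. l_S(g) ≤ b.

open import Defs
open import Data.Nat using (ℕ; NonZero; _<_; _+_; _/_; zero; suc; _∸_; _≤_; _%_; z≤n; s≤s; _*_; s≤s⁻¹; _≤?_)
open import Data.Nat.Properties
open import Data.Nat.DivMod using (_mod_; m%n<n; m%n%n≡m%n; %-distribˡ-+; [m+n]%n≡m%n; m<n⇒m%n≡m; m≡m%n+[m/n]*n; /-monoˡ-≤)
open import Data.Fin using (Fin; toℕ)
open import Data.Fin.Properties using (toℕ-injective; toℕ-fromℕ<; toℕ<n)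
import Data.Fin.Properties as Fin
open import Data.Bool using (true; false; not)
import Data.Bool.Properties as Bool
open import Data.Product using (_×_; _,_; ∃-syntax)
open import Data.Product.Properties using (≡-dec)
open import Data.Sum using (_⊎_; inj₁; inj₂)
open import Data.List using (List; []; _∷_; length)
open import Data.List.Relation.Unary.All using (All; []; _∷_)
open import Data.List.Relation.Unary.Any using (Any; here; there; any?)
open import Data.List.Membership.Propositional using (_∈_; find; lose)
open import Data.Empty using (⊥-elim)
open import Function using (_∘_)
open import Relation.Binary.Definitions using (DecidableEquality)
open import Relation.Binary.PropositionalEquality
open import Relation.Nullary using (Dec; yes; no; ¬_)
open import Relation.Nullary.Decidable using (map′)
open import Relation.Unary using (Decidable)

-- Least witnesses.  A witness of a decidable predicate on ℕ can be improved
-- to the least one; this turns "g has a word of length ≤ b" into l_S(g) ≤ b.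
module _ {P : ℕ → Set} (P? : Decidable P) where

  LeastWitness≤ : ℕ → Set
  LeastWitness≤ n = ∃[ k ] (P k × k ≤ n × (∀ j → P j → k ≤ j))

  search : ∀ n → LeastWitness≤ n ⊎ (∀ j → j ≤ n → ¬ P j)
  search zero with P? zero
  ... | yes p0 = inj₁ (0 , p0 , z≤n , λ _ _ → z≤n)
  ... | no ¬p0 = inj₂ λ { .zero z≤n → ¬p0 }
  search (suc n) with search n
  ... | inj₁ (k , pk , k≤n , least) = inj₁ (k , pk , m≤n⇒m≤1+n k≤n , least)
  ... | inj₂ none with P? (suc n)
  ...   | yes p = inj₁ (suc n , p , ≤-refl , λ j pj → ≮⇒≥ λ j<1+n → none j (s≤s⁻¹ j<1+n) pj)
  ...   | no ¬p = inj₂ below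
    where
      below : ∀ j → j ≤ suc n → ¬ P j
      below j j≤1+n with m≤n⇒m<n∨m≡n j≤1+n
      ... | inj₁ j<1+n = none j (s≤s⁻¹ j<1+n)
      ... | inj₂ refl = ¬p

  least-witness : ∀ {n} → P n → LeastWitness≤ n
  least-witness {n} pn with search n
  ... | inj₁ least = least
  ... | inj₂ none = ⊥-elim (none n ≤-refl pn)

n≤1+[n/2]*2 : ∀ n → n ≤ 1 + n / 2 * 2
n≤1+[n/2]*2 n = begin
    n                  ≡⟨ m≡m%n+[m/n]*n n 2 ⟩
    n % 2 + n / 2 * 2  ≤⟨ +-monoˡ-≤ (n / 2 * 2) (s≤s⁻¹ (m%n<n n 2)) ⟩
    1 + n / 2 * 2      ∎
  where open ≤-Reasoning

complement-≤half : ∀ {n c} → n / 2 < c → n ∸ c ≤ n / 2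
complement-≤half {n} {c} h<c = m≤n+o⇒m∸n≤o n c (begin
    n                  ≤⟨ n≤1+[n/2]*2 n ⟩
    1 + h * 2          ≡⟨ cong suc (trans (*-comm h 2) (cong (h +_) (+-identityʳ h))) ⟩
    suc h + h          ≤⟨ +-monoˡ-≤ h h<c ⟩
    c + h              ∎)
  where
    open ≤-Reasoning
    h = n / 2

module Words {A : Set} (S : List A) where

  SomeWord : (List A → Set) → ℕ → Set
  SomeWord Q k = ∃[ w ] (All (_∈ S) w × length w ≡ k × Q w)

  someWord? : {Q : List A → Set} → Decidable Q → ∀ k → Dec (SomeWord Q k)
  someWord? Q? zero = map′ (λ q → [] , [] , refl , q) (λ { ([] , _ , _ , q) → q }) (Q? [])
  someWord? {Q} Q? (suc k) = map′ from to (any? (λ s → someWord? (Q? ∘ (s ∷_)) k) S)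
    where
      from : Any (λ s → SomeWord (Q ∘ (s ∷_)) k) S → SomeWord Q (suc k)
      from first with find first
      ... | s , s∈S , (w , w⊆S , len , q) = s ∷ w , s∈S ∷ w⊆S , cong suc len , q
      to : SomeWord Q (suc k) → Any (λ s → SomeWord (Q ∘ (s ∷_)) k) S
      to (s ∷ w , s∈S ∷ w⊆S , len , q) = lose s∈S (w , w⊆S , suc-injective len , q)

module Dihedral (n : ℕ) .{{_ : NonZero n}} where

  _≟ᴰ_ : DecidableEquality (D n)
  _≟ᴰ_ = ≡-dec Fin._≟_ Bool._≟_

  wordLength-≤ : (S : List (D n)) {g : D n} (w : List (D n)) → IsWord S w → prod w ≡ g →
                 ∃[ k ] (WordLength S g k × k ≤ length w)
  wordLength-≤ S {g} w w⊆S w↦g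
    with least-witness (Words.someWord? S (λ v → prod v ≟ᴰ g)) (w , w⊆S , refl , w↦g)
  ... | k , (v , v⊆S , len , v↦g) , k≤ , least =
    k , ((v , v⊆S , v↦g , len) , λ u u⊆S u↦g → least (length u) (u , u⊆S , refl , u↦g)) , k≤

  infix 4 _≈_
  _≈_ : ℕ → ℕ → Set
  a ≈ b = a % n ≡ b % n

  ≡⇒≈ : ∀ {a b} → a ≡ b → a ≈ b
  ≡⇒≈ = cong (_% n)

  %≈ : ∀ a → a % n ≈ a
  %≈ a = m%n%n≡m%n a n

  +-≈ : ∀ {a b c d} → a ≈ b → c ≈ d → a + c ≈ b + d
  +-≈ {a} {b} {c} {d} a≈b c≈d = begin
      (a + c) % n          ≡⟨ %-distribˡ-+ a c n ⟩
      (a % n + c % n) % n  ≡⟨ cong₂ (λ u v → (u + v) % n) a≈b c≈d ⟩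
      (b % n + d % n) % n  ≡⟨ %-distribˡ-+ b d n ⟨
      (b + d) % n          ∎
    where open ≡-Reasoning

  n≈0 : n ≈ 0
  n≈0 = [m+n]%n≡m%n 0 n

  neg : ℕ → ℕ
  neg z = n ∸ z % n

  +-neg : ∀ z → z + neg z ≈ 0
  +-neg z = begin
      (z + neg z) % n        ≡⟨ +-≈ (%≈ z) refl ⟨
      (z % n + neg z) % n    ≡⟨ cong (_% n) (m+[n∸m]≡n (<⇒≤ (m%n<n z n))) ⟩
      n % n                  ≡⟨ n≈0 ⟩
      0 % n                  ∎
    where open ≡-Reasoning

  neg-sub : ∀ {x z a} → x + z ≈ a → a + neg z ≈ x
  neg-sub {x} {z} {a} x+z≈a = begin
      (a + neg z) % n        ≡⟨ +-≈ x+z≈a refl ⟨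
      (x + z + neg z) % n    ≡⟨ ≡⇒≈ (+-assoc x z (neg z)) ⟩
      (x + (z + neg z)) % n  ≡⟨ +-≈ {x} refl (+-neg z) ⟩
      (x + 0) % n            ≡⟨ ≡⇒≈ (+-identityʳ x) ⟩
      x % n                  ∎
    where open ≡-Reasoning

  toℕ-mod : ∀ a → toℕ (a mod n) ≈ a
  toℕ-mod a = trans (cong (_% n) (toℕ-fromℕ< (m%n<n a n))) (%≈ a)

  mod-cong : ∀ {a b} → a ≈ b → a mod n ≡ b mod n
  mod-cong {a} {b} a≈b = toℕ-injective (begin
      toℕ (a mod n)  ≡⟨ toℕ-fromℕ< (m%n<n a n) ⟩
      a % n          ≡⟨ a≈b ⟩
      b % n          ≡⟨ toℕ-fromℕ< (m%n<n b n) ⟨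
      toℕ (b mod n)  ∎)
    where open ≡-Reasoning

  mod-toℕ : (c : Fin n) → toℕ c mod n ≡ c
  mod-toℕ c = toℕ-injective (trans (toℕ-fromℕ< (m%n<n (toℕ c) n)) (m<n⇒m%n≡m (toℕ<n c)))

  refl· : ∀ a z e → refl′ a · (z mod n , e) ≡ ((a + neg z) mod n , not e)
  refl· a z e = cong (_, not e) (mod-cong (+-≈ (toℕ-mod a) (≡⇒≈ (cong (n ∸_) (toℕ-fromℕ< (m%n<n z n))))))

  refl-cong : ∀ {a b} → a ≈ b → refl′ a ≡ refl′ b
  refl-cong = cong (_, true) ∘ mod-cong

  refl·one : ∀ a → refl′ a · one ≡ refl′ a
  refl·one a = trans (refl· a 0 false) (refl-cong (neg-sub (≡⇒≈ (+-identityʳ a))))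

  refl·refl : ∀ {x z a} → x + z ≈ a → refl′ a · refl′ z ≡ rot x
  refl·refl {x} {z} {a} x+z≈a = trans (refl· a z true) (cong (_, false) (mod-cong (neg-sub x+z≈a)))

  refl·refl·refl : ∀ {x a b z} → x + b ≈ a + z → refl′ a · (refl′ b · refl′ z) ≡ refl′ x
  refl·refl·refl {x} {a} {b} {z} x+b≈a+z = begin
      refl′ a · (refl′ b · refl′ z)  ≡⟨ cong (refl′ a ·_) (refl· b z true) ⟩
      refl′ a · rot (b + neg z)      ≡⟨ refl· a (b + neg z) false ⟩
      refl′ (a + neg (b + neg z))    ≡⟨ refl-cong (neg-sub x+b-z≈a) ⟩
      refl′ x                        ∎
    where
      open ≡-Reasoning
      x+b-z≈a : x + (b + neg z) ≈ a
      x+b-z≈a = begin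
          (x + (b + neg z)) % n  ≡⟨ ≡⇒≈ (+-assoc x b (neg z)) ⟨
          (x + b + neg z) % n    ≡⟨ +-≈ x+b≈a+z refl ⟩
          (a + z + neg z) % n    ≡⟨ neg-sub (≡⇒≈ refl) ⟩
          a % n                  ∎

  conj-reflection : (g : D n) (c : Fin n) → ∃[ c′ ] (g · (c , true) · g ⁻¹ ≡ (c′ , true))
  conj-reflection (a , false) c = _ , refl
  conj-reflection (a , true) c = _ , refl

  S : List (D n)
  S = S₃ n

  f₀∈S : refl′ 0 ∈ S
  f₀∈S = here refl

  f₁∈S : refl′ 1 ∈ S
  f₁∈S = there (here refl)

  f₃∈S : refl′ 3 ∈ S
  f₃∈S = there (there (here refl))

  S-reflections : ∀ {s} → s ∈ S → ∃[ c ] (s ≡ (c , true))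
  S-reflections (here refl) = _ , refl
  S-reflections (there (here refl)) = _ , refl
  S-reflections (there (there (here refl))) = _ , refl

  Reach : ℕ → ℕ → Set
  Reach x k = ∃[ w ] (IsWord S w × prod w ≡ refl′ x × length w ≤ k)

  reach-weaken : ∀ {x k k′} → k ≤ k′ → Reach x k → Reach x k′
  reach-weaken k≤k′ (w , w⊆S , w↦x , len) = w , w⊆S , w↦x , ≤-trans len k≤k′

  reach-letter : ∀ {x a} → refl′ a ∈ S → x ≈ a → Reach x 1
  reach-letter {x} {a} a∈S x≈a =
    refl′ a ∷ [] , a∈S ∷ [] , trans (refl·one a) (refl-cong (sym x≈a)) , ≤-refl

  reach-extend : ∀ {x a b z k} → refl′ a ∈ S → refl′ b ∈ S → x + b ≈ a + z →
                 Reach z k → Reach x (2 + k)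
  reach-extend {a = a} {b} a∈S b∈S x+b≈a+z (w , w⊆S , w↦z , len) =
    refl′ a ∷ refl′ b ∷ w , a∈S ∷ b∈S ∷ w⊆S ,
    trans (cong (λ v → refl′ a · (refl′ b · v)) w↦z) (refl·refl·refl x+b≈a+z) ,
    s≤s (s≤s len)

  -- f_x = (f₃ f₀)^q f_(x mod 3), with f₂ = f₃ f₁ f₀
  reach-up : ∀ x → Reach x (x + 1)
  reach-up 0 = reach-letter f₀∈S refl
  reach-up 1 = reach-weaken (n≤1+n 1) (reach-letter f₁∈S refl)
  reach-up 2 = reach-extend f₃∈S f₁∈S refl (reach-letter f₀∈S refl)
  reach-up (suc (suc (suc x))) =
    reach-weaken (n≤1+n _) (reach-extend f₃∈S f₀∈S (≡⇒≈ (+-identityʳ _)) (reach-up x))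

  downCost : ℕ → ℕ
  downCost 0 = 1
  downCost 1 = 3
  downCost (suc (suc y)) = 3 + y

  downCost-≤ : ∀ y → downCost y ≤ 2 + y
  downCost-≤ 0 = s≤s z≤n
  downCost-≤ 1 = ≤-refl
  downCost-≤ (suc (suc y)) = n≤1+n _

  -- with ⌊n/2⌋ ≥ 2 the extra cost of f_(n−1) (and of f_n) is absorbed
  downCost-≤half : ∀ {h} y → 2 ≤ h → y ≤ h → downCost y ≤ h + 1
  downCost-≤half {h} 0 _ _ = m≤n+m 1 h
  downCost-≤half 1 2≤h _ = +-monoˡ-≤ 1 2≤h
  downCost-≤half (suc (suc y)) _ y≤h = ≤-trans (≤-reflexive (+-comm 1 (2 + y))) (+-monoˡ-≤ 1 y≤h)

  -- f_(n−y) = (f₀ f₃)^q f_(n − y mod 3), with f_(n−1) = f₀ f₁ f₀, f_(n−2) = f₀ f₃ f₁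
  reach-down : ∀ x y → x + y ≡ n → Reach x (downCost y)
  reach-down x 0 x+0≡n = reach-letter f₀∈S (trans (≡⇒≈ (trans (sym (+-identityʳ x)) x+0≡n)) n≈0)
  reach-down x 1 x+1≡n = reach-extend f₀∈S f₁∈S (trans (≡⇒≈ x+1≡n) n≈0) (reach-letter f₀∈S refl)
  reach-down x 2 x+2≡n =
    reach-extend f₀∈S f₃∈S x+3≈1 (reach-letter f₁∈S refl)
    where
      x+3≈1 : x + 3 ≈ 1
      x+3≈1 = trans (≡⇒≈ (sym (+-assoc x 2 1))) (+-≈ (trans (≡⇒≈ x+2≡n) n≈0) refl)
  reach-down x (suc (suc (suc y))) x+3+y≡n =
    reach-weaken (s≤s (s≤s (downCost-≤ y)))
      (reach-extend f₀∈S f₃∈S refl (reach-down (x + 3) y (trans (+-assoc x 3 y) x+3+y≡n)))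

  -- reflections f_c directly, rotations r^c = f₀ f_(n−c)
  generates : Generates S
  generates (c , true) with reach-up (toℕ c)
  ... | w , w⊆S , w↦c , _ = w , w⊆S , trans w↦c (cong (_, true) (mod-toℕ c))
  generates (c , false) with reach-up (n ∸ toℕ c)
  ... | w , w⊆S , w↦z , _ =
    refl′ 0 ∷ w , f₀∈S ∷ w⊆S ,
    trans (cong (refl′ 0 ·_) w↦z)
      (trans (refl·refl (trans (≡⇒≈ (m+[n∸m]≡n (<⇒≤ (toℕ<n c)))) n≈0)) (cong (_, false) (mod-toℕ c)))

  module _ (3<n : 3 < n) where

    reach-reflection : (c : Fin n) → Reach (toℕ c) (n / 2 + 1)
    reach-reflection c with toℕ c ≤? n / 2
    ... | yes c≤h = reach-weaken (+-monoˡ-≤ 1 c≤h) (reach-up (toℕ c))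
    ... | no c≰h =
      reach-weaken (downCost-≤half (n ∸ toℕ c) 2≤h (complement-≤half (≰⇒> c≰h)))
        (reach-down (toℕ c) (n ∸ toℕ c) (m+[n∸m]≡n (<⇒≤ (toℕ<n c))))
      where
        2≤h : 2 ≤ n / 2
        2≤h = /-monoˡ-≤ 2 3<n

    reflection-length : (c : Fin n) → ∃[ k ] (WordLength S (c , true) k × k ≤ n / 2 + 1)
    reflection-length c with reach-reflection c
    ... | w , w⊆S , w↦c , len with wordLength-≤ S w w⊆S (trans w↦c (cong (_, true) (mod-toℕ c)))
    ...   | k , l[c]≡k , k≤len = k , l[c]≡k , ≤-trans k≤len len

    λ₁-bound : λ₁≤ S (n / 2 + 1)
    λ₁-bound g s s∈S with S-reflections s∈S
    ... | c , refl with conj-reflection g c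
    ...   | c′ , conj≡c′ rewrite conj≡c′ = reflection-length c′

lemma5 : (n : ℕ) .{{_ : NonZero n}} → 3 < n →
    Generates (S₃ n) × λ₁≤ (S₃ n) (n / 2 + 1)
lemma5 n 3<n = generates , λ₁-bound 3<n
  where open Dihedral n
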